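{- Let $p\ge 5$ be a prime. A $\Phi_{\frac{p+1}{2}}$-sequence $(a_n)_{n\in\mathbb{Z}}$ in $\mathbb{F}_p$ is complete if and only if $a_n=b^n$ for all $n$, where $b$ is a $\Phi_{\frac{p+1}{2}}$-primitive root. Moreover, in this case $b=\frac{p-1}{2}$.
   Context: For a prime $p\ge 5$ and $\kappa\in\{2,\dots,p-2\}$, a sequence $(a_n)_{n\in\mathbb{Z}}$ of elements of $\mathbb{F}_p$ is a $\Phi_\kappa$-sequence if $a_0=1$ and $a_{n+\kappa}=a_n+a_{n+1}$ in $\mathbb{F}_p$ for all $n\in\mathbb{Z}$. It is complete if it is periodic with period $p-1$ and $\{a_1,\dots,a_{p-2}\}=\{2,\dots,p-1\}$. A $\Phi_\kappa$-primitive root is a primitive root $b$ mod $p$ (in $\mathbb{F}_p$) with $b^\kappa=b+1$. -}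

module Defs where

open import Data.Nat as ℕ using (ℕ; zero; suc; _∸_; _≤_; _<_; NonZero)
open import Data.Nat.DivMod using (_mod_; _/_)
open import Data.Fin using (Fin; toℕ)
open import Data.Integer as ℤ using (ℤ; +_; -[1+_])
open import Data.Product using (Σ; _×_; ∃)
open import Relation.Binary.PropositionalEquality using (_≡_)
open import Relation.Nullary using (¬_)
open import Function.Bundles using (_⇔_)

module 𝔽 (p : ℕ) .{{_ : NonZero p}} where

  F : Set
  F = Fin p

  ι : ℕ → F
  ι n = n mod p

  _⊕_ : F → F → F
  x ⊕ y = ι (toℕ x ℕ.+ toℕ y)

  _⊗_ : F → F → F
  x ⊗ y = ι (toℕ x ℕ.* toℕ y)

  one : F
  one = ι 1

  _^ℕ_ : F → ℕ → F
  x ^ℕ zero = one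
  x ^ℕ suc n = x ⊗ (x ^ℕ n)

  -- multiplicative inverse (for p prime and x ≠ 0, x⁻¹ = x^(p-2) by Fermat)
  inv : F → F
  inv x = x ^ℕ (p ∸ 2)

  _^ℤ_ : F → ℤ → F
  x ^ℤ (+ n) = x ^ℕ n
  x ^ℤ -[1+ n ] = inv x ^ℕ suc n

  IsΦSeq : ℕ → (ℤ → F) → Set
  IsΦSeq κ a = (a (+ 0) ≡ one) × (∀ (n : ℤ) → a (n ℤ.+ + κ) ≡ a n ⊕ a (n ℤ.+ + 1))

  Complete : (ℤ → F) → Set
  Complete a =
    (∀ (n : ℤ) → a (n ℤ.+ + (p ∸ 1)) ≡ a n) ×
    (∀ (x : F) → (∃ λ (i : ℕ) → (1 ≤ i) × (i ≤ p ∸ 2) × (a (+ i) ≡ x)) ⇔ (2 ≤ toℕ x))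

  IsPrimitiveRoot : F → Set
  IsPrimitiveRoot b = (b ^ℕ (p ∸ 1) ≡ one) × (∀ (k : ℕ) → 1 ≤ k → k < p ∸ 1 → ¬ (b ^ℕ k ≡ one))

  IsΦPrimitiveRoot : ℕ → F → Set
  IsΦPrimitiveRoot κ b = IsPrimitiveRoot b × (b ^ℕ κ ≡ b ⊕ one)

module Submission where

-- Write p = 2m + 1, so that κ = m + 1 and p − 1 = 2m. If a Φ_κ-sequence has period 2m,
-- unfolding a_{n+1} = a_{n+1+2m} = a_{(n+m)+κ} twice by the recurrence gives a_{n+m} = −a_n,
-- and applying this at n + 1 gives a_n + 2a_{n+1} = 0. Hence a_{n+1} = m·a_n, because m = −1/2
-- in 𝔽_p, and a_n = m^n. Completeness then makes m a primitive root, and the recurrence at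
-- n = 0 gives m^κ = m + 1. Conversely, the powers of a primitive root b have period p − 1, and
-- b^0, …, b^{p−2} are distinct and nonzero, so b^1, …, b^{p−2} take every value except 0 and 1.
-- Primality is used only to make p odd.

open import Defs
open import Data.Nat using (ℕ; _≤_; _+_; _∸_; _/_; NonZero)
open import Data.Nat.Primality using (Prime)
open import Data.Integer using (ℤ)
open import Data.Product using (_×_; ∃)
open import Relation.Binary.PropositionalEquality using (_≡_)
open import Function.Bundles using (_⇔_)

open import Algebra.Bundles using (CommutativeRing)
open import Algebra.Consequences.Propositional
  using (comm∧idˡ⇒id; comm∧invˡ⇒inv; comm∧distrˡ⇒distr)
import Algebra.Properties.Group as GroupProperties
import Algebra.Properties.Monoid as MonoidProperties
open import Data.Fin as Fin using (Fin; toℕ; punchOut)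
open import Data.Fin.Properties
  using (toℕ-injective; toℕ-fromℕ<; toℕ<n; any?; punchOut-injective; injective⇒≤)
  renaming (_≟_ to _≟ᶠ_)
open import Data.Integer as ℤ using (+_; -[1+_])
import Data.Integer.Properties as ℤ
open import Data.Nat as ℕ using (zero; suc; _*_; _%_; _<_; z≤n; s≤s)
open import Data.Nat.DivMod
  using (m%n<n; m<n⇒m%n≡m; %-distribˡ-+; %-distribˡ-*; %-remove-+ʳ; m*n/n≡m)
open import Data.Nat.Divisibility using (_∣_; divides; ∣-refl; m%n≡0⇒n∣m; ∣n⇒∣m*n; n∣m*n)
open import Data.Nat.Primality using (composite-≢; prime⇒nonZero; prime⇒¬composite)
import Data.Nat.Properties as ℕ
open import Data.Nat.Tactic.RingSolver using (solve-∀)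
open import Data.Product using (_,_; proj₁; proj₂)
open import Data.Sum using (_⊎_; inj₁; inj₂)
open import Function.Bundles using (mk⇔; Equivalence)
open import Function.Definitions using (Injective)
open import Level using (0ℓ)
open import Relation.Binary.Definitions using (tri<; tri≈; tri>)
open import Relation.Binary.PropositionalEquality
  using (refl; sym; trans; cong; cong₂; isEquivalence; _≢_; ≢-sym; module ≡-Reasoning)
open import Relation.Nullary using (yes; no; contradiction)

injective⇒surjective : ∀ {n} {f : Fin n → Fin n} → Injective _≡_ _≡_ f →
                       ∀ y → ∃ λ x → f x ≡ y
injective⇒surjective {n} {f} f-injective y with any? (λ x → f x ≟ᶠ y)
... | yes hit = hit
... | no miss = contradiction (injective⇒≤ extend-injective) ℕ.1+n≰n
  where
  extend : Fin (suc n) → Fin n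
  extend Fin.zero    = y
  extend (Fin.suc x) = f x

  extend-injective : Injective _≡_ _≡_ extend
  extend-injective {Fin.zero}  {Fin.zero}   _      = refl
  extend-injective {Fin.zero}  {Fin.suc x}  y≡fx   = contradiction (x , sym y≡fx) miss
  extend-injective {Fin.suc x} {Fin.zero}   fx≡y   = contradiction (x , fx≡y) miss
  extend-injective {Fin.suc x} {Fin.suc x′} fx≡fx′ = cong Fin.suc (f-injective fx≡fx′)

module ModularArithmetic (p : ℕ) .{{_ : NonZero p}} where
  open 𝔽 p

  0# : F
  0# = ι 0

  -_ : F → F
  - x = ι (p ∸ toℕ x)

  toℕ-ι : ∀ n → toℕ (ι n) ≡ n % p
  toℕ-ι n = toℕ-fromℕ< (m%n<n n p)

  ι-toℕ : ∀ x → ι (toℕ x) ≡ x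
  ι-toℕ x = toℕ-injective (trans (toℕ-ι (toℕ x)) (m<n⇒m%n≡m (toℕ<n x)))

  ι-cong-% : ∀ {m n} → m % p ≡ n % p → ι m ≡ ι n
  ι-cong-% {m} {n} eq = toℕ-injective (trans (toℕ-ι m) (trans eq (sym (toℕ-ι n))))

  ι-homo-+ : ∀ m n → ι m ⊕ ι n ≡ ι (m + n)
  ι-homo-+ m n = trans (cong₂ (λ u v → ι (u + v)) (toℕ-ι m) (toℕ-ι n))
                       (ι-cong-% (sym (%-distribˡ-+ m n p)))

  ι-homo-* : ∀ m n → ι m ⊗ ι n ≡ ι (m * n)
  ι-homo-* m n = trans (cong₂ (λ u v → ι (u * v)) (toℕ-ι m) (toℕ-ι n))
                       (ι-cong-% (sym (%-distribˡ-* m n p)))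

  ι-homo-+ˡ : ∀ m y → ι m ⊕ y ≡ ι (m + toℕ y)
  ι-homo-+ˡ m y = trans (cong (ι m ⊕_) (sym (ι-toℕ y))) (ι-homo-+ m (toℕ y))

  ι-remove-+ʳ : ∀ m {n} → p ∣ n → ι (m + n) ≡ ι m
  ι-remove-+ʳ m {n} p∣n = ι-cong-% {m + n} {m} (%-remove-+ʳ m p∣n)

  ι-homo-+ʳ : ∀ x n → x ⊕ ι n ≡ ι (toℕ x + n)
  ι-homo-+ʳ x n = trans (cong (_⊕ ι n) (sym (ι-toℕ x))) (ι-homo-+ (toℕ x) n)

  ι-homo-*ˡ : ∀ m y → ι m ⊗ y ≡ ι (m * toℕ y)
  ι-homo-*ˡ m y = trans (cong (ι m ⊗_) (sym (ι-toℕ y))) (ι-homo-* m (toℕ y))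

  ι-homo-*ʳ : ∀ x n → x ⊗ ι n ≡ ι (toℕ x * n)
  ι-homo-*ʳ x n = trans (cong (_⊗ ι n) (sym (ι-toℕ x))) (ι-homo-* (toℕ x) n)

  ⊕-comm : ∀ x y → x ⊕ y ≡ y ⊕ x
  ⊕-comm x y = cong ι (ℕ.+-comm (toℕ x) (toℕ y))

  ⊗-comm : ∀ x y → x ⊗ y ≡ y ⊗ x
  ⊗-comm x y = cong ι (ℕ.*-comm (toℕ x) (toℕ y))

  ⊕-assoc : ∀ x y z → (x ⊕ y) ⊕ z ≡ x ⊕ (y ⊕ z)
  ⊕-assoc x y z = trans (ι-homo-+ˡ (toℕ x + toℕ y) z)
    (trans (cong ι (ℕ.+-assoc (toℕ x) (toℕ y) (toℕ z)))
           (sym (ι-homo-+ʳ x (toℕ y + toℕ z))))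

  ⊗-assoc : ∀ x y z → (x ⊗ y) ⊗ z ≡ x ⊗ (y ⊗ z)
  ⊗-assoc x y z = trans (ι-homo-*ˡ (toℕ x * toℕ y) z)
    (trans (cong ι (ℕ.*-assoc (toℕ x) (toℕ y) (toℕ z)))
           (sym (ι-homo-*ʳ x (toℕ y * toℕ z))))

  ⊕-identityˡ : ∀ x → 0# ⊕ x ≡ x
  ⊕-identityˡ x = trans (ι-homo-+ˡ 0 x) (ι-toℕ x)

  ⊗-identityˡ : ∀ x → one ⊗ x ≡ x
  ⊗-identityˡ x = trans (ι-homo-*ˡ 1 x) (trans (cong ι (ℕ.*-identityˡ (toℕ x))) (ι-toℕ x))

  -‿inverseˡ : ∀ x → (- x) ⊕ x ≡ 0#
  -‿inverseˡ x = trans (ι-homo-+ˡ (p ∸ toℕ x) x)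
    (trans (cong ι (ℕ.m∸n+n≡m (ℕ.<⇒≤ (toℕ<n x)))) (ι-remove-+ʳ 0 ∣-refl))

  ⊗-distribˡ-⊕ : ∀ x y z → x ⊗ (y ⊕ z) ≡ (x ⊗ y) ⊕ (x ⊗ z)
  ⊗-distribˡ-⊕ x y z = trans (ι-homo-*ʳ x (toℕ y + toℕ z))
    (trans (cong ι (ℕ.*-distribˡ-+ (toℕ x) (toℕ y) (toℕ z)))
           (sym (ι-homo-+ (toℕ x * toℕ y) (toℕ x * toℕ z))))

  commutativeRing : CommutativeRing 0ℓ 0ℓ
  commutativeRing = record
    { Carrier = F ; _≈_ = _≡_ ; _+_ = _⊕_ ; _*_ = _⊗_ ; -_ = -_ ; 0# = 0# ; 1# = one
    ; isCommutativeRing = record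
      { isRing = record
        { +-isAbelianGroup = record
          { isGroup = record
            { isMonoid = record
              { isSemigroup = record
                { isMagma = record { isEquivalence = isEquivalence ; ∙-cong = cong₂ _⊕_ }
                ; assoc = ⊕-assoc }
              ; identity = comm∧idˡ⇒id ⊕-comm ⊕-identityˡ }
            ; inverse = comm∧invˡ⇒inv ⊕-comm -‿inverseˡ
            ; ⁻¹-cong = cong -_ }
          ; comm = ⊕-comm }
        ; *-cong = cong₂ _⊗_
        ; *-assoc = ⊗-assoc
        ; *-identity = comm∧idˡ⇒id ⊗-comm ⊗-identityˡ
        ; distrib = comm∧distrˡ⇒distr (cong₂ _⊕_) ⊗-comm ⊗-distribˡ-⊕ }
      ; *-comm = ⊗-comm } }

  open CommutativeRing commutativeRing public using (+-group; *-monoid; zeroˡ; *-identityʳ)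
  open MonoidProperties *-monoid public using (cancelˡ)

  ⊗-cancelˡ-unit : ∀ {c c′ x y} → c ⊗ c′ ≡ one → c ⊗ x ≡ c ⊗ y → x ≡ y
  ⊗-cancelˡ-unit {c} {c′} {x} {y} cc′≡1 cx≡cy = begin
    x              ≡⟨ cancelˡ {c′} {c} c′c≡1 x ⟨
    c′ ⊗ (c ⊗ x)   ≡⟨ cong (c′ ⊗_) cx≡cy ⟩
    c′ ⊗ (c ⊗ y)   ≡⟨ cancelˡ {c′} {c} c′c≡1 y ⟩
    y              ∎
    where
    open ≡-Reasoning
    c′c≡1 : c′ ⊗ c ≡ one
    c′c≡1 = trans (⊗-comm c′ c) cc′≡1

  ^ℕ-homo-⊗ : ∀ x i j → x ^ℕ (i + j) ≡ (x ^ℕ i) ⊗ (x ^ℕ j)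
  ^ℕ-homo-⊗ x zero    j = sym (⊗-identityˡ (x ^ℕ j))
  ^ℕ-homo-⊗ x (suc i) j =
    trans (cong (x ⊗_) (^ℕ-homo-⊗ x i j)) (sym (⊗-assoc x (x ^ℕ i) (x ^ℕ j)))

module GeometricSequences (p : ℕ) .{{_ : NonZero p}} where
  open 𝔽 p
  open ModularArithmetic p

  -- ℤ.suc n rather than n ℤ.+ + 1, so that b ^ℤ_ satisfies it by computation.
  IsGeometric : F → (ℤ → F) → Set
  IsGeometric c s = ∀ n → s (ℤ.suc n) ≡ c ⊗ s n

  geometric-shift : ∀ {c s} → IsGeometric c s → ∀ k → IsGeometric c (λ n → s (n ℤ.+ k))
  geometric-shift {s = s} s-geometric k n =
    trans (cong s (ℤ.+-assoc (+ 1) n k)) (s-geometric (n ℤ.+ k))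

  geometric-^ℕ : ∀ {c s} → IsGeometric c s → s (+ 0) ≡ one → ∀ j → s (+ j) ≡ c ^ℕ j
  geometric-^ℕ         s-geometric s₀≡1 zero    = s₀≡1
  geometric-^ℕ {c} {s} s-geometric s₀≡1 (suc j) =
    trans (s-geometric (+ j)) (cong (c ⊗_) (geometric-^ℕ {c} {s} s-geometric s₀≡1 j))

  geometric-unique : ∀ {c c′ s t} → c ⊗ c′ ≡ one → IsGeometric c s → IsGeometric c t →
                     s (+ 0) ≡ t (+ 0) → ∀ n → s n ≡ t n
  geometric-unique {c} {c′} {s} {t} cc′≡1 s-geometric t-geometric s₀≡t₀ = agree
    where
    forward : ∀ n → s n ≡ t n → s (ℤ.suc n) ≡ t (ℤ.suc n)
    forward n sₙ≡tₙ =
      trans (s-geometric n) (trans (cong (c ⊗_) sₙ≡tₙ) (sym (t-geometric n)))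

    backward : ∀ n → s (ℤ.suc n) ≡ t (ℤ.suc n) → s n ≡ t n
    backward n eq = ⊗-cancelˡ-unit {c} {c′} cc′≡1
      (trans (sym (s-geometric n)) (trans eq (t-geometric n)))

    agree : ∀ n → s n ≡ t n
    agree (+ zero)     = s₀≡t₀
    agree (+ suc j)    = forward (+ j) (agree (+ j))
    agree -[1+ zero ]  = backward -[1+ zero ] (agree (+ 0))
    agree -[1+ suc j ] = backward -[1+ suc j ] (agree -[1+ j ])

  ^ℤ-isGeometric : ∀ {b} → b ⊗ inv b ≡ one → IsGeometric b (b ^ℤ_)
  ^ℤ-isGeometric     _      (+ _)        = refl
  ^ℤ-isGeometric {b} bb⁻¹≡1 -[1+ zero ]  = sym (cancelˡ {b} {inv b} bb⁻¹≡1 one)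
  ^ℤ-isGeometric {b} bb⁻¹≡1 -[1+ suc j ] =
    sym (cancelˡ {b} {inv b} bb⁻¹≡1 (inv b ^ℕ suc j))

-- p is written 2 + r so that p ∸ 1, p ∸ 2, 0# and one reduce to constructor form.
module PrimitiveRoots (r : ℕ) where
  p : ℕ
  p = 2 + r

  open 𝔽 p
  open ModularArithmetic p
  open GeometricSequences p

  one≢0# : one ≢ 0#
  one≢0# ()

  2≤toℕ⇒≢0∧≢1 : ∀ {x} → 2 ≤ toℕ x → x ≢ 0# × x ≢ one
  2≤toℕ⇒≢0∧≢1 {Fin.suc Fin.zero}    (s≤s ())
  2≤toℕ⇒≢0∧≢1 {Fin.suc (Fin.suc _)} _ = (λ ()) , (λ ())

  ≢0∧≢1⇒2≤toℕ : ∀ {x} → x ≢ 0# → x ≢ one → 2 ≤ toℕ x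
  ≢0∧≢1⇒2≤toℕ {Fin.zero}            x≢0 _   = contradiction refl x≢0
  ≢0∧≢1⇒2≤toℕ {Fin.suc Fin.zero}    _   x≢1 = contradiction refl x≢1
  ≢0∧≢1⇒2≤toℕ {Fin.suc (Fin.suc _)} _   _   = s≤s (s≤s z≤n)

  unit⇒≢0 : ∀ {x y} → x ⊗ y ≡ one → x ≢ 0#
  unit⇒≢0 {y = y} xy≡1 refl = one≢0# (trans (sym xy≡1) (zeroˡ y))

  -- inv b is b ^ℕ (p ∸ 2), so b ⊗ inv b unfolds to b ^ℕ (p ∸ 1).
  ⊗-inv : ∀ {b} → b ^ℕ (p ∸ 1) ≡ one → b ⊗ inv b ≡ one
  ⊗-inv b^[p-1]≡1 = b^[p-1]≡1

  ^-unit : ∀ {b i} → b ^ℕ (p ∸ 1) ≡ one → i ≤ p ∸ 1 →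
           (b ^ℕ i) ⊗ (b ^ℕ (p ∸ 1 ∸ i)) ≡ one
  ^-unit {b} {i} b^[p-1]≡1 i≤p-1 = trans (sym (^ℕ-homo-⊗ b i (p ∸ 1 ∸ i)))
    (trans (cong (b ^ℕ_) (ℕ.m+[n∸m]≡n i≤p-1)) b^[p-1]≡1)

  ^-≢0 : ∀ {b i} → b ^ℕ (p ∸ 1) ≡ one → i ≤ p ∸ 1 → b ^ℕ i ≢ 0#
  ^-≢0 {b} {i} b^[p-1]≡1 i≤p-1 =
    unit⇒≢0 {b ^ℕ i} {b ^ℕ (p ∸ 1 ∸ i)} (^-unit b^[p-1]≡1 i≤p-1)

  module _ {b : F} (b-primitive : IsPrimitiveRoot b) where

    ^-≢-< : ∀ {i j} → i < j → j < p ∸ 1 → b ^ℕ i ≢ b ^ℕ j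
    ^-≢-< {i} {j} i<j j<p-1 b^i≡b^j = proj₂ b-primitive (j ∸ i)
      (ℕ.m<n⇒0<n∸m i<j) (ℕ.≤-<-trans (ℕ.m∸n≤m j i) j<p-1) b^[j∸i]≡1
      where
      open ≡-Reasoning
      b^i-unit : (b ^ℕ i) ⊗ (b ^ℕ (p ∸ 1 ∸ i)) ≡ one
      b^i-unit = ^-unit (proj₁ b-primitive) (ℕ.<⇒≤ (ℕ.<-trans i<j j<p-1))

      b^[j∸i]≡1 : b ^ℕ (j ∸ i) ≡ one
      b^[j∸i]≡1 = ⊗-cancelˡ-unit {b ^ℕ i} {b ^ℕ (p ∸ 1 ∸ i)} b^i-unit (begin
        (b ^ℕ i) ⊗ (b ^ℕ (j ∸ i))  ≡⟨ ^ℕ-homo-⊗ b i (j ∸ i) ⟨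
        b ^ℕ (i + (j ∸ i))         ≡⟨ cong (b ^ℕ_) (ℕ.m+[n∸m]≡n (ℕ.<⇒≤ i<j)) ⟩
        b ^ℕ j                     ≡⟨ b^i≡b^j ⟨
        b ^ℕ i                     ≡⟨ *-identityʳ (b ^ℕ i) ⟨
        (b ^ℕ i) ⊗ one             ∎)

    ^-injective : ∀ {i j} → i < p ∸ 1 → j < p ∸ 1 → b ^ℕ i ≡ b ^ℕ j → i ≡ j
    ^-injective {i} {j} i<p-1 j<p-1 b^i≡b^j with ℕ.<-cmp i j
    ... | tri< i<j _ _ = contradiction b^i≡b^j (^-≢-< i<j j<p-1)
    ... | tri≈ _ i≡j _ = i≡j
    ... | tri> _ _ j<i = contradiction (sym b^i≡b^j) (^-≢-< j<i i<p-1)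

    0≢^ : ∀ (i : Fin (p ∸ 1)) → 0# ≢ b ^ℕ toℕ i
    0≢^ i = ≢-sym (^-≢0 (proj₁ b-primitive) (ℕ.<⇒≤ (toℕ<n i)))

    punchedPower : Fin (p ∸ 1) → Fin (p ∸ 1)
    punchedPower i = punchOut (0≢^ i)

    punchedPower-injective : Injective _≡_ _≡_ punchedPower
    punchedPower-injective {i} {j} eq = toℕ-injective
      (^-injective (toℕ<n i) (toℕ<n j) (punchOut-injective (0≢^ i) (0≢^ j) eq))

    ^-surjective : ∀ {x} → x ≢ 0# → ∃ λ i → i < p ∸ 1 × b ^ℕ i ≡ x
    ^-surjective x≢0 with injective⇒surjective punchedPower-injective (punchOut (≢-sym x≢0))
    ... | i , eq = toℕ i , toℕ<n i , punchOut-injective (0≢^ i) (≢-sym x≢0) eq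

  powers-complete : ∀ {b a} → IsPrimitiveRoot b → (∀ n → a n ≡ b ^ℤ n) → Complete a
  powers-complete {b} {a} b-primitive a≡b^ = periodic , λ x → mk⇔ image⇒2≤ 2≤⇒image
    where
    b⊗b⁻¹≡1 : b ⊗ inv b ≡ one
    b⊗b⁻¹≡1 = ⊗-inv {b} (proj₁ b-primitive)

    a-geometric : IsGeometric b a
    a-geometric n = trans (a≡b^ (ℤ.suc n))
      (trans (^ℤ-isGeometric {b} b⊗b⁻¹≡1 n) (cong (b ⊗_) (sym (a≡b^ n))))

    periodic : ∀ n → a (n ℤ.+ + (p ∸ 1)) ≡ a n
    periodic = geometric-unique {b} {inv b} b⊗b⁻¹≡1
      (geometric-shift {b} a-geometric (+ (p ∸ 1))) a-geometric
      (trans (a≡b^ (+ (p ∸ 1))) (trans (proj₁ b-primitive) (sym (a≡b^ (+ 0)))))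

    image⇒2≤ : ∀ {x} → (∃ λ i → 1 ≤ i × i ≤ p ∸ 2 × a (+ i) ≡ x) → 2 ≤ toℕ x
    image⇒2≤ {x} (i , 1≤i , i≤p-2 , aᵢ≡x) = ≢0∧≢1⇒2≤toℕ
      (λ x≡0 → ^-≢0 (proj₁ b-primitive) (ℕ.m≤n⇒m≤1+n i≤p-2) (trans b^i≡x x≡0))
      (λ x≡1 → proj₂ b-primitive i 1≤i (s≤s i≤p-2) (trans b^i≡x x≡1))
      where
      b^i≡x : b ^ℕ i ≡ x
      b^i≡x = trans (sym (a≡b^ (+ i))) aᵢ≡x

    2≤⇒image : ∀ {x} → 2 ≤ toℕ x → ∃ λ i → 1 ≤ i × i ≤ p ∸ 2 × a (+ i) ≡ x
    2≤⇒image {x} 2≤x = from-power (^-surjective b-primitive x≢0)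
      where
      x≢0 : x ≢ 0#
      x≢0 = proj₁ (2≤toℕ⇒≢0∧≢1 2≤x)

      from-power : (∃ λ i → i < p ∸ 1 × b ^ℕ i ≡ x) →
                   ∃ λ i → 1 ≤ i × i ≤ p ∸ 2 × a (+ i) ≡ x
      from-power (zero  , _         , b⁰≡x)  =
        contradiction (sym b⁰≡x) (proj₂ (2≤toℕ⇒≢0∧≢1 2≤x))
      from-power (suc i , s≤s i<p-2 , b^i≡x) =
        suc i , s≤s z≤n , i<p-2 , trans (a≡b^ (+ suc i)) b^i≡x

module ΦSequences (k : ℕ) where
  m : ℕ
  m = suc k

  p κ : ℕ
  p = suc (m + m)
  κ = suc m

  open 𝔽 p
  open ModularArithmetic p
  open GeometricSequences p
  open PrimitiveRoots (k + m) using (⊗-inv; 2≤toℕ⇒≢0∧≢1)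
  open GroupProperties +-group using (identityˡ-unique)

  -½ : F
  -½ = ι m

  halve : ∀ x y → (x ⊕ y) ⊕ y ≡ 0# → y ≡ -½ ⊗ x
  halve x y x+2y≡0 = begin
    y                       ≡⟨ ι-toℕ y ⟨
    ι Y                     ≡⟨ ι-remove-+ʳ Y (∣n⇒∣m*n m p∣X+2Y) ⟨
    ι (Y + m * (X + Y + Y)) ≡⟨ cong ι (p-identity m X Y) ⟩
    ι (m * X + Y * p)       ≡⟨ ι-remove-+ʳ (m * X) (n∣m*n Y) ⟩
    ι (m * X)               ≡⟨ ι-homo-*ˡ m x ⟨
    -½ ⊗ x                  ∎
    where
    open ≡-Reasoning
    X Y : ℕ
    X = toℕ x
    Y = toℕ y

    p∣X+2Y : p ∣ X + Y + Y
    p∣X+2Y = m%n≡0⇒n∣m (X + Y + Y) p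
      (trans (sym (toℕ-ι (X + Y + Y))) (cong toℕ (trans (sym (ι-homo-+ˡ (X + Y) y)) x+2y≡0)))

    p-identity : ∀ m X Y → Y + m * (X + Y + Y) ≡ m * X + Y * suc (m + m)
    p-identity = solve-∀

  Periodic : (ℤ → F) → Set
  Periodic a = ∀ n → a (n ℤ.+ + (p ∸ 1)) ≡ a n

  Φ-antiperiodic : ∀ {a} → IsΦSeq κ a → Periodic a → ∀ n → a (n ℤ.+ + m) ⊕ a n ≡ 0#
  Φ-antiperiodic {a} (_ , Φ) periodic n =
    identityˡ-unique (aₙ₊ m ⊕ a n) (aₙ₊ 1) (sym (begin
      aₙ₊ 1                           ≡⟨ periodic (n ℤ.+ + 1) ⟨
      a (n ℤ.+ + 1 ℤ.+ + (m + m))     ≡⟨ shift 1 (m + m) ⟩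
      aₙ₊ (suc (m + m))               ≡⟨ cong aₙ₊ (ℕ.+-suc m m) ⟨
      aₙ₊ (m + κ)                     ≡⟨ shift m κ ⟨
      a (n ℤ.+ + m ℤ.+ + κ)           ≡⟨ Φ (n ℤ.+ + m) ⟩
      aₙ₊ m ⊕ a (n ℤ.+ + m ℤ.+ + 1)   ≡⟨ cong (aₙ₊ m ⊕_) (shift m 1) ⟩
      aₙ₊ m ⊕ aₙ₊ (m + 1)             ≡⟨ cong (λ i → aₙ₊ m ⊕ aₙ₊ i) (ℕ.+-comm m 1) ⟩
      aₙ₊ m ⊕ aₙ₊ κ                   ≡⟨ cong (aₙ₊ m ⊕_) (Φ n) ⟩
      aₙ₊ m ⊕ (a n ⊕ aₙ₊ 1)           ≡⟨ ⊕-assoc (aₙ₊ m) (a n) (aₙ₊ 1) ⟨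
      (aₙ₊ m ⊕ a n) ⊕ aₙ₊ 1           ∎))
    where
    open ≡-Reasoning
    aₙ₊ : ℕ → F
    aₙ₊ i = a (n ℤ.+ + i)

    shift : ∀ i j → a (n ℤ.+ + i ℤ.+ + j) ≡ aₙ₊ (i + j)
    shift i j = cong a (ℤ.+-assoc n (+ i) (+ j))

  Φ-periodic⇒geometric : ∀ {a} → IsΦSeq κ a → Periodic a → IsGeometric -½ a
  Φ-periodic⇒geometric {a} φ@(_ , Φ) periodic n = begin
    a (ℤ.suc n)     ≡⟨ cong a (ℤ.+-comm (+ 1) n) ⟩
    a (n ℤ.+ + 1)   ≡⟨ halve (a n) (a (n ℤ.+ + 1)) aₙ+2aₙ₊₁≡0 ⟩
    -½ ⊗ a n        ∎
    where
    open ≡-Reasoning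
    aₙ+2aₙ₊₁≡0 : (a n ⊕ a (n ℤ.+ + 1)) ⊕ a (n ℤ.+ + 1) ≡ 0#
    aₙ+2aₙ₊₁≡0 = begin
      (a n ⊕ a (n ℤ.+ + 1)) ⊕ a (n ℤ.+ + 1)  ≡⟨ cong (_⊕ a (n ℤ.+ + 1)) (Φ n) ⟨
      a (n ℤ.+ + κ) ⊕ a (n ℤ.+ + 1)          ≡⟨ cong (_⊕ a (n ℤ.+ + 1)) a[n+1+m]≡a[n+κ] ⟨
      a (n ℤ.+ + 1 ℤ.+ + m) ⊕ a (n ℤ.+ + 1)  ≡⟨ Φ-antiperiodic φ periodic (n ℤ.+ + 1) ⟩
      0#                                     ∎
      where
      a[n+1+m]≡a[n+κ] : a (n ℤ.+ + 1 ℤ.+ + m) ≡ a (n ℤ.+ + κ)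
      a[n+1+m]≡a[n+κ] = cong a (ℤ.+-assoc n (+ 1) (+ m))

  complete⇒ΦPrimitivePowers : ∀ {a} → IsΦSeq κ a → Complete a →
                              ∃ λ b → IsΦPrimitiveRoot κ b × (∀ n → a n ≡ b ^ℤ n)
  complete⇒ΦPrimitivePowers {a} φ@(a₀≡1 , Φ) (periodic , image) =
    -½ , ((-½^[p-1]≡1 , -½^j≢1) , -½^κ≡-½+1) , a≡-½^
    where
    open ≡-Reasoning
    a-geometric : IsGeometric -½ a
    a-geometric = Φ-periodic⇒geometric φ periodic

    a≡-½^ℕ : ∀ j → a (+ j) ≡ -½ ^ℕ j
    a≡-½^ℕ = geometric-^ℕ { -½} {a} a-geometric a₀≡1

    -½^[p-1]≡1 : -½ ^ℕ (p ∸ 1) ≡ one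
    -½^[p-1]≡1 = trans (sym (a≡-½^ℕ (p ∸ 1))) (trans (periodic (+ 0)) a₀≡1)

    -½^j≢1 : ∀ j → 1 ≤ j → j < p ∸ 1 → -½ ^ℕ j ≢ one
    -½^j≢1 j 1≤j j<p-1 = proj₂ (2≤toℕ⇒≢0∧≢1
      (Equivalence.to (image (-½ ^ℕ j)) (j , 1≤j , ℕ.<⇒≤pred j<p-1 , a≡-½^ℕ j)))

    -½^κ≡-½+1 : -½ ^ℕ κ ≡ -½ ⊕ one
    -½^κ≡-½+1 = begin
      -½ ^ℕ κ            ≡⟨ a≡-½^ℕ κ ⟨
      a (+ κ)            ≡⟨ Φ (+ 0) ⟩
      a (+ 0) ⊕ a (+ 1)  ≡⟨ cong₂ _⊕_ a₀≡1 (trans (a≡-½^ℕ 1) (*-identityʳ -½)) ⟩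
      one ⊕ -½           ≡⟨ ⊕-comm one -½ ⟩
      -½ ⊕ one           ∎

    -½⊗-½⁻¹≡1 : -½ ⊗ inv -½ ≡ one
    -½⊗-½⁻¹≡1 = ⊗-inv { -½} -½^[p-1]≡1

    a≡-½^ : ∀ n → a n ≡ -½ ^ℤ n
    a≡-½^ = geometric-unique { -½} {inv -½} -½⊗-½⁻¹≡1
      a-geometric (^ℤ-isGeometric { -½} -½⊗-½⁻¹≡1) a₀≡1

  Φ-powers-base≡-½ : ∀ {a b} → IsΦSeq κ a → Periodic a →
                     (∀ n → a n ≡ b ^ℤ n) → b ≡ -½
  Φ-powers-base≡-½ {a} {b} φ@(a₀≡1 , _) periodic a≡b^ = begin
    b             ≡⟨ *-identityʳ b ⟨
    b ^ℤ (+ 1)    ≡⟨ a≡b^ (+ 1) ⟨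
    a (+ 1)       ≡⟨ Φ-periodic⇒geometric φ periodic (+ 0) ⟩
    -½ ⊗ a (+ 0)  ≡⟨ cong (-½ ⊗_) a₀≡1 ⟩
    -½ ⊗ one      ≡⟨ *-identityʳ -½ ⟩
    -½            ∎
    where open ≡-Reasoning

even⊎odd : ∀ n → ∃ λ q → n ≡ q + q ⊎ n ≡ suc (q + q)
even⊎odd zero = 0 , inj₁ refl
even⊎odd (suc n) with even⊎odd n
... | q , inj₁ n≡2q   = q , inj₂ (cong suc n≡2q)
... | q , inj₂ n≡2q+1 = suc q , inj₁ (trans (cong suc n≡2q+1) (sym (ℕ.+-suc (suc q) q)))

odd-prime : ∀ {p} → Prime p → 2 < p → ∃ λ k → p ≡ suc (suc k + suc k)
odd-prime {p} p-prime 2<p with even⊎odd p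
... | q , inj₁ refl =
  contradiction (composite-≢ 2 {{_}} {{prime⇒nonZero p-prime}} 2≢2q (divides q (2q≡q*2 q)))
                (prime⇒¬composite p-prime)
  where
  2≢2q : 2 ≢ q + q
  2≢2q 2≡2q = ℕ.<-irrefl 2≡2q 2<p

  2q≡q*2 : ∀ q → q + q ≡ q * 2
  2q≡q*2 = solve-∀
... | zero  , inj₂ refl = contradiction 2<p λ { (s≤s ()) }
... | suc k , inj₂ refl = k , refl

[p+1]/2≡ : ∀ m → (suc (m + m) + 1) / 2 ≡ suc m
[p+1]/2≡ m = trans (cong (_/ 2) (p+1≡[m+1]*2 m)) (m*n/n≡m (suc m) 2)
  where
  p+1≡[m+1]*2 : ∀ m → suc (m + m) + 1 ≡ suc m * 2
  p+1≡[m+1]*2 = solve-∀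

[p∸1]/2≡ : ∀ m → (suc (m + m) ∸ 1) / 2 ≡ m
[p∸1]/2≡ m = trans (cong (_/ 2) (2m≡m*2 m)) (m*n/n≡m m 2)
  where
  2m≡m*2 : ∀ m → m + m ≡ m * 2
  2m≡m*2 = solve-∀

mainTheorem13 : (p : ℕ) .{{nz : NonZero p}} → Prime p → 5 ≤ p →
    (a : ℤ → 𝔽.F p) → 𝔽.IsΦSeq p ((p + 1) / 2) a →
      (𝔽.Complete p a ⇔ (∃ λ (b : 𝔽.F p) → 𝔽.IsΦPrimitiveRoot p ((p + 1) / 2) b × (∀ (n : ℤ) → a n ≡ 𝔽._^ℤ_ p b n)))
      × (∀ (b : 𝔽.F p) → 𝔽.Complete p a → 𝔽.IsΦPrimitiveRoot p ((p + 1) / 2) b → (∀ (n : ℤ) → a n ≡ 𝔽._^ℤ_ p b n) → b ≡ 𝔽.ι p ((p ∸ 1) / 2))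
mainTheorem13 p p-prime 5≤p with odd-prime p-prime (ℕ.≤-trans (s≤s (s≤s (s≤s z≤n))) 5≤p)
... | k , refl rewrite [p+1]/2≡ (suc k) | [p∸1]/2≡ (suc k) = λ a φ →
  mk⇔ (complete⇒ΦPrimitivePowers φ)
      (λ (b , (b-primitive , _) , a≡b^) → powers-complete b-primitive a≡b^)
  , λ b (periodic , _) _ a≡b^ → Φ-powers-base≡-½ φ periodic a≡b^
  where
  open ΦSequences k
  open PrimitiveRoots (k + m) using (powers-complete)
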